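{- For every $r$-degenerate graph $H$, $R(H, K_{n,n}) = O(n^{r+1})$, where the implied constant depends only on $H$.
   Context: A graph is $r$-degenerate if every subgraph has a vertex of degree at most $r$. For graphs $H$ and $F$, $R(H,F)$ is the smallest $N$ such that for every graph $G$ on $N$ vertices, either $G$ contains a copy of $H$ or its complement $\overline{G}$ contains a copy of $F$. $K_{n,n}$ is the complete bipartite graph with both sides of size $n$. -}

module Defs where

open import Data.Nat using (ℕ; _≤_)
open import Data.Bool using (Bool; true; false; not; T)
open import Data.Fin using (Fin)
open import Data.Fin.Subset using (Subset; _∈_; Nonempty)
open import Data.Vec using (lookup; tabulate)
open import Data.Product using (Σ; ∃; _×_; _,_)
open import Data.Sum using (_⊎_)
open import Relation.Binary.PropositionalEquality using (_≡_; _≢_)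
open import Function.Definitions using (Injective)
open import Data.List using (List; length; filter)
open import Data.List.Base using (allFin)
open import Relation.Nullary.Decidable using (does)
open import Data.Bool using (_∧_)
open import Relation.Nullary using (yes; no; Dec)
open import Data.Bool.Properties using (T?)

record Graph (v : ℕ) : Set where
  field
    adj   : Fin v → Fin v → Bool
    sym   : ∀ x y → adj x y ≡ adj y x
    irref : ∀ x → adj x x ≡ false
open Graph public

complement : ∀ {v} → Graph v → Graph v
complement G = record
  { adj   = λ x y → adjC x y
  ; sym   = symC
  ; irref = irrC }
  where
  open import Data.Fin using (_≟_)
  adjC : _ → _ → Bool
  adjC x y with x ≟ y
  ... | yes _ = false
  ... | no  _ = not (adj G x y)
  symC : ∀ x y → adjC x y ≡ adjC y x
  symC x y with x ≟ y | y ≟ x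
  ... | yes _ | yes _ = Relation.Binary.PropositionalEquality.refl
  ... | yes p | no q = Data.Empty.⊥-elim (q (Relation.Binary.PropositionalEquality.sym p))
    where import Data.Empty
  ... | no p | yes q = Data.Empty.⊥-elim (p (Relation.Binary.PropositionalEquality.sym q))
    where import Data.Empty
  ... | no _ | no _ = Relation.Binary.PropositionalEquality.cong not (sym G x y)
  irrC : ∀ x → adjC x x ≡ false
  irrC x with x ≟ x
  ... | yes _ = Relation.Binary.PropositionalEquality.refl
  ... | no p = Data.Empty.⊥-elim (p Relation.Binary.PropositionalEquality.refl)
    where import Data.Empty

degreeIn : ∀ {v} → Graph v → Subset v → Fin v → ℕ
degreeIn G S x = length (filter (λ y → T? (lookup S y ∧ adj G x y)) (allFin _))

record Subgraph {v} (G : Graph v) : Set where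
  field
    verts  : Subset v
    edges  : Graph v
    sub    : ∀ x y → T (adj edges x y) → T (adj G x y)
    inside : ∀ x y → T (adj edges x y) → x ∈ verts
open Subgraph public

Degenerate : ℕ → ∀ {v} → Graph v → Set
Degenerate r G = (K : Subgraph G) → Nonempty (verts K) →
  ∃ λ x → x ∈ verts K × degreeIn (edges K) (verts K) x ≤ r

Contains : ∀ {k v} → Graph k → Graph v → Set
Contains H G = Σ (Fin _ → Fin _) λ f → Injective _≡_ _≡_ f ×
  (∀ x y → T (adj H x y) → T (adj G (f x) (f y)))

ContainsKnn : ∀ {v} → ℕ → Graph v → Set
ContainsKnn n G = Σ (Fin n → Fin _) λ a → Σ (Fin n → Fin _) λ b →
  Injective _≡_ _≡_ a × Injective _≡_ _≡_ b × (∀ i j → a i ≢ b j) ×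
  (∀ i j → T (adj G (a i) (b j)))

-- Embed H greedily into G, one vertex at a time, in the reverse of a degeneracy
-- ordering, so that every vertex has at most r neighbours embedded before it.
-- Along the way keep the invariant that a vertex u not yet embedded, with d ≤ r
-- embedded neighbours, has at least g(r − d) candidates: common G-neighbours of
-- the images of those neighbours, where g(0) = k + kn + 1 and
-- g(j + 1) = 2n + n g(j) + g(j).  To embed x, pick its image y among its
-- ≥ g(0) candidates, avoiding the ≤ k used vertices and every vertex having
-- fewer than g(j) neighbours among the candidates of some later neighbour u of x.
-- If some u has n such "sparse" vertices a₁ … aₙ, then its ≥ g(j + 1) candidates
-- contain n vertices outside the aᵢ and their neighbourhoods, which together
-- with the aᵢ span a K_{n,n} in the complement of G.  Finally g(r) = O(n^{r+1}).

module Submission where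

open import Defs
open import Data.Nat using (ℕ; _≤_; _*_; _^_; _+_)
open import Data.Product using (∃)
open import Data.Sum using (_⊎_)

open import Data.Bool using (Bool; true; false; not; T; _∧_; _∨_)
open import Data.Bool.Properties using (T?; ∧-comm; ∧-zeroʳ)
open import Data.Empty using (⊥-elim)
open import Data.Fin using (Fin; zero; suc; fromℕ<)
open import Data.Fin.Properties using (_≟_; suc-injective; any?)
open import Data.Fin.Subset using (_∈_)
import Data.List as List
open import Data.Nat
  using (zero; suc; _∸_; _<_; _≤?_; _≤ᵇ_; _<ᵇ_; z≤n; s≤s; _≤′_; ≤′-refl; ≤′-step; NonZero; >-nonZero; >-nonZero⁻¹)
open import Data.Nat.Properties hiding (_≟_; _≤?_; suc-injective)
open import Data.Nat.Tactic.RingSolver using (solve-∀)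
open import Data.Product using (Σ; _×_; _,_)
open import Data.Sum using (inj₁; inj₂; [_,_]′)
open import Data.Unit using (tt)
open import Data.Vec using (tabulate; lookup)
open import Data.Vec.Properties using (lookup∘tabulate; lookup⇒[]=; []=⇒lookup)
open import Function using (_∘_)
open import Function.Definitions using (Injective)
open import Relation.Binary.PropositionalEquality as ≡
  using (_≡_; _≢_; refl; trans; cong; cong₂; subst)
open import Relation.Nullary using (yes; no; ¬_; does)
open import Relation.Nullary.Decidable using (_×-dec_; dec-true)

T-∧⁺ : ∀ {a b} → T a → T b → T (a ∧ b)
T-∧⁺ {true} _ tb = tb

T-∧⁻ˡ : ∀ {a b} → T (a ∧ b) → T a
T-∧⁻ˡ {true} _ = tt

T-∧⁻ʳ : ∀ {a b} → T (a ∧ b) → T b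
T-∧⁻ʳ {true} tb = tb

T-∨⁺ˡ : ∀ {a b} → T a → T (a ∨ b)
T-∨⁺ˡ {true} _ = tt

T-∨⁺ʳ : ∀ {a b} → T b → T (a ∨ b)
T-∨⁺ʳ {true}  _  = tt
T-∨⁺ʳ {false} tb = tb

T-∨⁻ : ∀ {a b} → T (a ∨ b) → T a ⊎ T b
T-∨⁻ {true}  ta = inj₁ ta
T-∨⁻ {false} tb = inj₂ tb

T-not⁺ : ∀ {a} → ¬ T a → T (not a)
T-not⁺ {true}  ¬ta = ¬ta tt
T-not⁺ {false} _   = tt

T-not⁻ : ∀ {a} → T (not a) → ¬ T a
T-not⁻ {true} ()

≡true⇒T : ∀ {a} → a ≡ true → T a
≡true⇒T refl = tt

T⇒≡true : ∀ {a} → T a → a ≡ true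
T⇒≡true {true} _ = refl

_⇒ᵇ_ : Bool → Bool → Bool
true  ⇒ᵇ b = b
false ⇒ᵇ _ = true

T-⇒ᵇ⁺ : ∀ {a b} → (T a → T b) → T (a ⇒ᵇ b)
T-⇒ᵇ⁺ {true}  f = f tt
T-⇒ᵇ⁺ {false} _ = tt

T-⇒ᵇ⁻ : ∀ {a b} → T (a ⇒ᵇ b) → T a → T b
T-⇒ᵇ⁻ {true} tb _ = tb

anyᵇ : ∀ {m} → (Fin m → Bool) → Bool
anyᵇ {zero}  p = false
anyᵇ {suc m} p = p zero ∨ anyᵇ (p ∘ suc)

anyᵇ-intro : ∀ {m} (p : Fin m → Bool) i → T (p i) → T (anyᵇ p)
anyᵇ-intro p zero    t = T-∨⁺ˡ t
anyᵇ-intro p (suc i) t = T-∨⁺ʳ {p zero} (anyᵇ-intro (p ∘ suc) i t)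

anyᵇ-elim : ∀ {m} (p : Fin m → Bool) → T (anyᵇ p) → ∃ λ i → T (p i)
anyᵇ-elim {suc m} p t with T-∨⁻ {p zero} t
... | inj₁ t₀ = zero , t₀
... | inj₂ t₁ = let i , tᵢ = anyᵇ-elim (p ∘ suc) t₁ in suc i , tᵢ

allᵇ : ∀ {m} → (Fin m → Bool) → Bool
allᵇ {zero}  p = true
allᵇ {suc m} p = p zero ∧ allᵇ (p ∘ suc)

allᵇ-intro : ∀ {m} (p : Fin m → Bool) → (∀ i → T (p i)) → T (allᵇ p)
allᵇ-intro {zero}  p h = tt
allᵇ-intro {suc m} p h = T-∧⁺ (h zero) (allᵇ-intro (p ∘ suc) (h ∘ suc))

allᵇ-elim : ∀ {m} (p : Fin m → Bool) → T (allᵇ p) → ∀ i → T (p i)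
allᵇ-elim p t zero    = T-∧⁻ˡ t
allᵇ-elim p t (suc i) = allᵇ-elim (p ∘ suc) (T-∧⁻ʳ {p zero} t) i

boolToℕ : Bool → ℕ
boolToℕ false = 0
boolToℕ true  = 1

count : ∀ {m} → (Fin m → Bool) → ℕ
count {zero}  P = 0
count {suc m} P = boolToℕ (P zero) + count (P ∘ suc)

count≤ : ∀ {m} (P : Fin m → Bool) → count P ≤ m
count≤ {zero}  P = z≤n
count≤ {suc m} P with P zero
... | true  = s≤s (count≤ (P ∘ suc))
... | false = m≤n⇒m≤1+n (count≤ (P ∘ suc))

count-full : ∀ {m} (P : Fin m → Bool) → (∀ y → T (P y)) → count P ≡ m
count-full {zero}  P h = refl
count-full {suc m} P h with P zero | h zero
... | true | _ = cong suc (count-full (P ∘ suc) (h ∘ suc))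

count-empty : ∀ {m} (P : Fin m → Bool) → (∀ y → ¬ T (P y)) → count P ≡ 0
count-empty {zero}  P h = refl
count-empty {suc m} P h with P zero | h zero
... | false | _   = count-empty (P ∘ suc) (h ∘ suc)
... | true  | ¬t₀ = ⊥-elim (¬t₀ tt)

boolToℕ-mono : ∀ {a b} → (T a → T b) → boolToℕ a ≤ boolToℕ b
boolToℕ-mono {false}        _ = z≤n
boolToℕ-mono {true} {true}  _ = ≤-refl
boolToℕ-mono {true} {false} f = ⊥-elim (f tt)

count-mono : ∀ {m} (P Q : Fin m → Bool) → (∀ y → T (P y) → T (Q y)) → count P ≤ count Q
count-mono {zero}  P Q h = z≤n
count-mono {suc m} P Q h = +-mono-≤ (boolToℕ-mono (h zero)) (count-mono (P ∘ suc) (Q ∘ suc) (h ∘ suc))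

count-cover : ∀ {m} (P Q R : Fin m → Bool) → (∀ y → T (P y) → T (Q y) ⊎ T (R y)) →
  count P ≤ count Q + count R
count-cover {zero}  P Q R h = z≤n
count-cover {suc m} P Q R h = begin
  boolToℕ (P zero) + count (P ∘ suc)
    ≤⟨ +-mono-≤ (head (h zero)) (count-cover (P ∘ suc) (Q ∘ suc) (R ∘ suc) (h ∘ suc)) ⟩
  (q + r) + (count (Q ∘ suc) + count (R ∘ suc))
    ≡⟨ +-assoc q r _ ⟩
  q + (r + (count (Q ∘ suc) + count (R ∘ suc)))
    ≡⟨ cong (q +_) (x+[y+z]≡y+[x+z] r (count (Q ∘ suc)) _) ⟩
  q + (count (Q ∘ suc) + (r + count (R ∘ suc)))
    ≡⟨ +-assoc q _ _ ⟨
  (q + count (Q ∘ suc)) + (r + count (R ∘ suc)) ∎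
  where
  open ≤-Reasoning
  q r : ℕ
  q = boolToℕ (Q zero)
  r = boolToℕ (R zero)
  x+[y+z]≡y+[x+z] : ∀ x y z → x + (y + z) ≡ y + (x + z)
  x+[y+z]≡y+[x+z] = solve-∀
  head : ∀ {a b c} → (T a → T b ⊎ T c) → boolToℕ a ≤ boolToℕ b + boolToℕ c
  head {false}                _ = z≤n
  head {true} {true}          _ = s≤s z≤n
  head {true} {false} {true}  _ = s≤s z≤n
  head {true} {false} {false} f with f tt
  ... | inj₁ ()
  ... | inj₂ ()

count-< : ∀ {m} (P Q : Fin m → Bool) x → (∀ y → T (P y) → T (Q y)) →
  ¬ T (P x) → T (Q x) → count P < count Q
count-< P Q zero h ¬px qx with P zero | Q zero
... | true  | _    = ⊥-elim (¬px tt)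
... | false | true = s≤s (count-mono (P ∘ suc) (Q ∘ suc) (h ∘ suc))
count-< P Q (suc x) h ¬px qx = begin-strict
  boolToℕ (P zero) + count (P ∘ suc)
    <⟨ +-monoʳ-< (boolToℕ (P zero)) (count-< (P ∘ suc) (Q ∘ suc) x (h ∘ suc) ¬px qx) ⟩
  boolToℕ (P zero) + count (Q ∘ suc)
    ≤⟨ +-monoˡ-≤ _ (boolToℕ-mono (h zero)) ⟩
  boolToℕ (Q zero) + count (Q ∘ suc) ∎
  where open ≤-Reasoning

count-pos : ∀ {m} (P : Fin m → Bool) x → T (P x) → 0 < count P
count-pos {m} P x px = subst (_< count P) (count-empty {m} (λ _ → false) (λ _ ()))
  (count-< (λ _ → false) P x (λ _ ()) (λ ()) px)

count-≟ : ∀ {m} (c : Fin m) → count (λ z → does (c ≟ z)) ≤ 1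
count-≟ {suc m} zero = ≤-reflexive (cong suc (count-empty {m} (λ z → does (zero ≟ suc z)) (λ _ ())))
count-≟ (suc c) = count-≟ c

count-anyᵇ : ∀ {m} j (Q : Fin j → Fin m → Bool) c → (∀ i → count (Q i) ≤ c) →
  count (λ y → anyᵇ (λ i → Q i y)) ≤ j * c
count-anyᵇ {m} zero Q c h = ≤-reflexive (count-empty {m} (λ _ → false) (λ _ ()))
count-anyᵇ (suc j) Q c h = ≤-trans
  (count-cover _ (Q zero) (λ y → anyᵇ (λ i → Q (suc i) y)) (λ y → T-∨⁻))
  (+-mono-≤ (h zero) (count-anyᵇ j (Q ∘ suc) c (h ∘ suc)))

length-filter-tabulate : ∀ {A : Set} {m} (P : A → Bool) (f : Fin m → A) →
  List.length (List.filter (T? ∘ P) (List.tabulate f)) ≡ count (P ∘ f)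
length-filter-tabulate {m = zero}  P f = refl
length-filter-tabulate {m = suc m} P f with P (f zero)
... | true  = cong suc (length-filter-tabulate P (f ∘ suc))
... | false = length-filter-tabulate P (f ∘ suc)

select : ∀ {m} n (P : Fin m → Bool) → n ≤ count P →
  Σ (Fin n → Fin m) λ a → Injective _≡_ _≡_ a × (∀ i → T (P (a i)))
select zero    P _ = (λ ()) , (λ { {()} }) , (λ ())
select {zero} (suc n) P ()
select {suc m} (suc n) P size with P zero in P₀
... | false = let a , a-inj , a∈P = select (suc n) (P ∘ suc) size
              in suc ∘ a , a-inj ∘ suc-injective , a∈P
... | true  = let a , a-inj , a∈P = select n (P ∘ suc) (≤-pred size)
              in a′ a , a′-inj a-inj , a′∈P a∈P
  where
  a′ : (Fin n → Fin m) → Fin (suc n) → Fin (suc m)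
  a′ a zero    = zero
  a′ a (suc i) = suc (a i)
  a′-inj : ∀ {a} → Injective _≡_ _≡_ a → Injective _≡_ _≡_ (a′ a)
  a′-inj a-inj {zero}  {zero}  _ = refl
  a′-inj a-inj {suc i} {suc j} e = cong suc (a-inj (suc-injective e))
  a′∈P : ∀ {a} → (∀ i → T (P (suc (a i)))) → ∀ i → T (P (a′ a i))
  a′∈P a∈P zero    = ≡true⇒T P₀
  a′∈P a∈P (suc i) = a∈P i

count-witness : ∀ {m} (P : Fin m → Bool) → 0 < count P → ∃ λ y → T (P y)
count-witness P pos = let a , _ , a∈P = select 1 P pos in a zero , a∈P zero

_-_ : ∀ {m} → (Fin m → Bool) → Fin m → Fin m → Bool
(S - x) w = S w ∧ not (does (x ≟ w))

-⊆ : ∀ {m} {S : Fin m → Bool} {x w} → T ((S - x) w) → T (S w)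
-⊆ {S = S} {w = w} = T-∧⁻ˡ {S w}

∉- : ∀ {m} {S : Fin m → Bool} x → ¬ T ((S - x) x)
∉- {S = S} x t with x ≟ x
... | yes _   = T-∧⁻ʳ {S x} t
... | no x≢x  = x≢x refl

∈- : ∀ {m} {S : Fin m → Bool} {x w} → T (S w) → x ≢ w → T ((S - x) w)
∈- {x = x} {w} sw x≢w with x ≟ w
... | yes x≡w = ⊥-elim (x≢w x≡w)
... | no  _   = T-∧⁺ sw tt

count-- : ∀ {m} {S : Fin m → Bool} {x} → T (S x) → count (S - x) < count S
count-- {S = S} {x} x∈S = count-< (S - x) S x (λ _ → -⊆ {S = S} {x}) (∉- {S = S} x) x∈S

complement-adj : ∀ {N} (G : Graph N) {a b} → a ≢ b → ¬ T (adj G a b) → T (adj (complement G) a b)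
complement-adj G {a} {b} a≢b ¬ab with a ≟ b
... | yes a≡b = a≢b a≡b
... | no  _   = T-not⁺ ¬ab

containsKnn-zero : ∀ {N} (G : Graph N) → ContainsKnn 0 G
containsKnn-zero G = (λ ()) , (λ ()) , (λ { {()} }) , (λ { {()} }) , (λ ()) , (λ ())

fewNeighbours⇒complementKnn : ∀ {N} (G : Graph N) {n} t (C : Fin N → Bool) (a : Fin n → Fin N) →
  Injective _≡_ _≡_ a → (∀ i → count (λ z → C z ∧ adj G (a i) z) ≤ t) →
  n + (n + n * t) ≤ count C → ContainsKnn n (complement G)
fewNeighbours⇒complementKnn {N} G {n} t C a a-inj sparse big = beside (select n far far-large)
  where
  near : Fin N → Bool
  near z = anyᵇ (λ i → does (a i ≟ z)) ∨ anyᵇ (λ i → C z ∧ adj G (a i) z)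
  far : Fin N → Bool
  far z = C z ∧ not (near z)
  split : ∀ z → T (C z) → T (far z) ⊎ T (near z)
  split z cz with near z
  ... | true  = inj₂ tt
  ... | false = inj₁ (T-∧⁺ cz tt)
  near-small : count near ≤ n + n * t
  near-small = ≤-trans (count-cover near _ _ (λ z → T-∨⁻ {anyᵇ (λ i → does (a i ≟ z))}))
    (+-mono-≤ (≤-trans (count-anyᵇ n (λ i z → does (a i ≟ z)) 1 (count-≟ ∘ a)) (≤-reflexive (*-identityʳ n)))
              (count-anyᵇ n (λ i z → C z ∧ adj G (a i) z) t sparse))
  far-large : n ≤ count far
  far-large = +-cancelʳ-≤ (n + n * t) n (count far)
    (≤-trans big (≤-trans (count-cover C far near split) (+-monoʳ-≤ (count far) near-small)))
  beside : Σ (Fin n → Fin N) (λ b → Injective _≡_ _≡_ b × (∀ j → T (far (b j)))) →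
    ContainsKnn n (complement G)
  beside (b , b-inj , b∈far) = a , b , a-inj , b-inj , disjoint , cross
    where
    b-far : ∀ j → ¬ T (near (b j))
    b-far j = T-not⁻ (T-∧⁻ʳ {C (b j)} (b∈far j))
    disjoint : ∀ i j → a i ≢ b j
    disjoint i j e = b-far j (T-∨⁺ˡ (anyᵇ-intro _ i (≡true⇒T (dec-true (a i ≟ b j) e))))
    cross : ∀ i j → T (adj (complement G) (a i) (b j))
    cross i j = complement-adj G (disjoint i j) λ ab → b-far j
      (T-∨⁺ʳ {anyᵇ (λ i → does (a i ≟ b j))}
        (anyᵇ-intro (λ i → C (b j) ∧ adj G (a i) (b j)) i (T-∧⁺ (T-∧⁻ˡ {C (b j)} (b∈far j)) ab)))

∈-tabulate⁺ : ∀ {m} (S : Fin m → Bool) {x} → T (S x) → x ∈ tabulate S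
∈-tabulate⁺ S {x} t = lookup⇒[]= x (tabulate S) (trans (lookup∘tabulate S x) (T⇒≡true t))

∈-tabulate⁻ : ∀ {m} (S : Fin m → Bool) {x} → x ∈ tabulate S → T (S x)
∈-tabulate⁻ S {x} x∈S = ≡true⇒T (trans (≡.sym (lookup∘tabulate S x)) ([]=⇒lookup x∈S))

induced : ∀ {v} (H : Graph v) → (Fin v → Bool) → Subgraph H
induced H S = record
  { verts  = tabulate S
  ; edges  = record
    { adj   = λ a b → (S a ∧ S b) ∧ adj H a b
    ; sym   = λ a b → cong₂ _∧_ (∧-comm (S a) (S b)) (sym H a b)
    ; irref = λ a → trans (cong ((S a ∧ S a) ∧_) (irref H a)) (∧-zeroʳ _) }
  ; sub    = λ a b → T-∧⁻ʳ {S a ∧ S b}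
  ; inside = λ a b t → ∈-tabulate⁺ S (T-∧⁻ˡ {S a} (T-∧⁻ˡ {S a ∧ S b} t)) }

degreeIn≡count : ∀ {v} (G : Graph v) S x → degreeIn G S x ≡ count (λ y → lookup S y ∧ adj G x y)
degreeIn≡count G S x = length-filter-tabulate (λ y → lookup S y ∧ adj G x y) (λ y → y)

degenerate⇒lowDegree : ∀ {r v} {H : Graph v} → Degenerate r H → (S : Fin v → Bool) → ∀ x₀ → T (S x₀) →
  ∃ λ x → T (S x) × count (λ w → S w ∧ adj H x w) ≤ r
degenerate⇒lowDegree {r} {H = H} dgn S x₀ x₀∈S with dgn (induced H S) (x₀ , ∈-tabulate⁺ S x₀∈S)
... | x , x∈K , degK≤r = x , x∈S , ≤-trans (count-mono _ _ into-K)
  (≤-trans (≤-reflexive (≡.sym (degreeIn≡count (edges (induced H S)) (tabulate S) x))) degK≤r)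
  where
  x∈S : T (S x)
  x∈S = ∈-tabulate⁻ S x∈K
  into-K : ∀ w → T (S w ∧ adj H x w) → T (lookup (tabulate S) w ∧ ((S x ∧ S w) ∧ adj H x w))
  into-K w t = T-∧⁺ (subst T (≡.sym (lookup∘tabulate S w)) (T-∧⁻ˡ {S w} t))
                    (T-∧⁺ (T-∧⁺ x∈S (T-∧⁻ˡ {S w} t)) (T-∧⁻ʳ {S w} t))

threshold : ℕ → ℕ → ℕ → ℕ
threshold k n zero    = suc (k + k * n)
threshold k n (suc j) = n + (n + n * threshold k n j) + threshold k n j

threshold-mono : ∀ k n {i j} → i ≤ j → threshold k n i ≤ threshold k n j
threshold-mono k n i≤j = go (≤⇒≤′ i≤j)
  where
  go : ∀ {i j} → i ≤′ j → threshold k n i ≤ threshold k n j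
  go ≤′-refl       = ≤-refl
  go (≤′-step i≤j) = ≤-trans (go i≤j) (m≤n+m _ _)

thresholdConstant : ℕ → ℕ → ℕ
thresholdConstant k zero    = k + k + 1
thresholdConstant k (suc j) = 2 * thresholdConstant k j + 2

threshold≤ : ∀ k n j .{{_ : NonZero n}} → threshold k n j ≤ thresholdConstant k j * n ^ suc j
threshold≤ k n zero = begin
  suc (k + k * n)   ≤⟨ s≤s (+-monoˡ-≤ (k * n) (m≤m*n k n)) ⟩
  suc (k * n + k * n) ≤⟨ +-monoˡ-≤ (k * n + k * n) (>-nonZero⁻¹ n) ⟩
  n + (k * n + k * n) ≡⟨ rearrange k n ⟩
  (k + k + 1) * (n * 1) ∎
  where
  open ≤-Reasoning
  rearrange : ∀ k n → n + (k * n + k * n) ≡ (k + k + 1) * (n * 1)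
  rearrange = solve-∀
threshold≤ k n (suc j) = begin
  n + (n + n * g) + g                  ≤⟨ +-mono-≤ (+-mono-≤ n≤nP (+-mono-≤ n≤nP (*-monoʳ-≤ n ih)))
                                                   (≤-trans ih (m≤n*m (D * P) n)) ⟩
  n * P + (n * P + n * (D * P)) + n * (D * P) ≡⟨ rearrange n P D ⟩
  (2 * D + 2) * (n * P)                ∎
  where
  open ≤-Reasoning
  g D P : ℕ
  g = threshold k n j
  D = thresholdConstant k j
  P = n ^ suc j
  ih : g ≤ D * P
  ih = threshold≤ k n j
  n≤nP : n ≤ n * P
  n≤nP = m≤m*n n P {{>-nonZero (m^n>0 n (suc j))}}
  rearrange : ∀ n P D → n * P + (n * P + n * (D * P)) + n * (D * P) ≡ (2 * D + 2) * (n * P)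
  rearrange = solve-∀

module GreedyEmbedding {k N} (H : Graph k) (G : Graph N) (r n : ℕ) where

  g : ℕ → ℕ
  g = threshold k n

  degreeWithin : (Fin k → Bool) → Fin k → ℕ
  degreeWithin S u = count (λ w → S w ∧ adj H u w)

  degreeWithin-mono : ∀ {S S′} → (∀ w → T (S w) → T (S′ w)) → ∀ u → degreeWithin S u ≤ degreeWithin S′ u
  degreeWithin-mono {S} S⊆S′ u = count-mono _ _ λ w t → T-∧⁺ (S⊆S′ w (T-∧⁻ˡ {S w} t)) (T-∧⁻ʳ {S w} t)

  candidates : (Fin k → Fin N) → (Fin k → Bool) → Fin k → Fin N → Bool
  candidates φ S u z = allᵇ (λ w → (S w ∧ adj H u w) ⇒ᵇ adj G (φ w) z)

  record PartialEmbedding (S : Fin k → Bool) : Set where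
    field
      φ              : Fin k → Fin N
      injective      : ∀ {a b} → T (S a) → T (S b) → φ a ≡ φ b → a ≡ b
      adj-preserving : ∀ {a b} → T (S a) → T (S b) → T (adj H a b) → T (adj G (φ a) (φ b))
      room           : ∀ u → ¬ T (S u) → degreeWithin S u ≤ r →
                       g (r ∸ degreeWithin S u) ≤ count (candidates φ S u)

  Outcome : (Fin k → Bool) → Set
  Outcome S = ContainsKnn n (complement G) ⊎ PartialEmbedding S

  emptyEmbedding : ∀ {S} → g r ≤ N → (∀ y → ¬ T (S y)) → PartialEmbedding S
  emptyEmbedding {S} large none = record
    { φ              = λ _ → z₀
    ; injective      = λ a∈S → ⊥-elim (none _ a∈S)
    ; adj-preserving = λ a∈S → ⊥-elim (none _ a∈S)
    ; room           = λ u _ _ → begin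
        g (r ∸ degreeWithin S u)              ≤⟨ threshold-mono k n (m∸n≤m r (degreeWithin S u)) ⟩
        g r                                   ≤⟨ large ⟩
        N                                     ≡⟨ count-full (candidates (λ _ → z₀) S u) (everything u) ⟨
        count (candidates (λ _ → z₀) S u)     ∎ }
    where
    open ≤-Reasoning
    z₀ : Fin N
    z₀ = fromℕ< (≤-trans (threshold-mono k n (z≤n {r})) large)
    everything : ∀ u z → T (candidates (λ _ → z₀) S u z)
    everything u z = allᵇ-intro _ λ w → T-⇒ᵇ⁺ λ t → ⊥-elim (none w (T-∧⁻ˡ {S w} t))

  module Extension (S : Fin k → Bool) (x : Fin k) (x∈S : T (S x)) (deg-x : degreeWithin S x ≤ r)
                   (e : PartialEmbedding (S - x)) where
    open PartialEmbedding e

    E : Fin k → Bool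
    E = S - x

    E⊆S : ∀ w → T (E w) → T (S w)
    E⊆S w = -⊆ {S = S} {x}

    ∈E : ∀ {w} → T (S w) → x ≢ w → T (E w)
    ∈E = ∈- {S = S}

    degree-drop : ∀ {u} → T (adj H u x) → degreeWithin E u < degreeWithin S u
    degree-drop {u} ux = count-< _ _ x (λ w t → T-∧⁺ (E⊆S w (T-∧⁻ˡ {E w} t)) (T-∧⁻ʳ {E w} t))
      (λ t → ∉- {S = S} x (T-∧⁻ˡ {E x} t)) (T-∧⁺ x∈S ux)

    room-outside-S : ∀ u → ¬ T (S u) → degreeWithin S u ≤ r →
      g (r ∸ degreeWithin E u) ≤ count (candidates φ E u)
    room-outside-S u u∉S du = room u (u∉S ∘ E⊆S u) (≤-trans (degreeWithin-mono E⊆S u) du)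

    Cx : Fin N → Bool
    Cx = candidates φ E x

    affected : Fin k → Bool
    affected u = not (S u) ∧ (adj H u x ∧ (degreeWithin S u ≤ᵇ r))

    affected⁻ : ∀ {u} → T (affected u) → ¬ T (S u) × T (adj H u x) × degreeWithin S u ≤ r
    affected⁻ {u} t = T-not⁻ (T-∧⁻ˡ {not (S u)} t) , T-∧⁻ˡ {adj H u x} t′ ,
                      ≤ᵇ⇒≤ _ _ (T-∧⁻ʳ {adj H u x} t′)
      where
      t′ : T (adj H u x ∧ (degreeWithin S u ≤ᵇ r))
      t′ = T-∧⁻ʳ {not (S u)} t

    sparse : Fin k → Fin N → Bool
    sparse u y = count (λ z → candidates φ E u z ∧ adj G y z) <ᵇ g (r ∸ degreeWithin S u)

    spoilers : Fin k → Fin N → Bool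
    spoilers u y = Cx y ∧ sparse u y

    used : Fin N → Bool
    used y = anyᵇ (λ w → E w ∧ does (φ w ≟ y))

    spoilt : Fin N → Bool
    spoilt y = anyᵇ (λ u → affected u ∧ sparse u y)

    many-spoilers⇒Knn : ∀ u → T (affected u) → n ≤ count (spoilers u) → ContainsKnn n (complement G)
    many-spoilers⇒Knn u aff many =
      let a , a-inj , a∈spoilers = select n (spoilers u) many
      in fewNeighbours⇒complementKnn G (g j) (candidates φ E u) a a-inj
           (λ i → <⇒≤ (<ᵇ⇒< _ _ (T-∧⁻ʳ {Cx (a i)} (a∈spoilers i)))) large
      where
      j : ℕ
      j = r ∸ degreeWithin S u
      large : n + (n + n * g j) ≤ count (candidates φ E u)
      large = let u∉S , ux , du = affected⁻ aff in
        ≤-trans (m≤m+n _ (g j)) (≤-trans (threshold-mono k n (∸-monoʳ-< (degree-drop ux) du))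
                                         (room-outside-S u u∉S du))

    good : Fin N → Bool
    good y = Cx y ∧ (not (used y) ∧ not (spoilt y))

    few-spoilers⇒good : (∀ u → T (affected u) → count (spoilers u) < n) →
      ∃ λ y → T (Cx y) × ¬ T (used y) × (∀ u → T (affected u) → ¬ T (sparse u y))
    few-spoilers⇒good few = unpack (count-witness good (+-cancelʳ-≤ (k + k * n) 1 (count good) (begin
      suc (k + k * n)                       ≤⟨ threshold-mono k n (z≤n {r ∸ degreeWithin E x}) ⟩
      g (r ∸ degreeWithin E x)              ≤⟨ room x (∉- {S = S} x) (≤-trans (degreeWithin-mono E⊆S x) deg-x) ⟩
      count Cx                              ≤⟨ count-cover Cx good bad split ⟩
      count good + count bad                ≤⟨ +-monoʳ-≤ (count good) (count-cover bad _ _ (λ y → T-∨⁻ {used y})) ⟩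
      count good + (count used + count (λ y → anyᵇ (λ u → affected u ∧ spoilers u y)))
        ≤⟨ +-monoʳ-≤ (count good) (+-mono-≤ used-few spoilt-few) ⟩
      count good + (k + k * n)              ∎)))
      where
      open ≤-Reasoning
      unpack : (∃ λ y → T (good y)) → ∃ λ y → T (Cx y) × ¬ T (used y) × (∀ u → T (affected u) → ¬ T (sparse u y))
      unpack (y , y-good) = y , T-∧⁻ˡ {Cx y} y-good , T-not⁻ (T-∧⁻ˡ {not (used y)} rest) ,
        λ u aff sp → T-not⁻ (T-∧⁻ʳ {not (used y)} rest) (anyᵇ-intro (λ u → affected u ∧ sparse u y) u (T-∧⁺ aff sp))
        where
        rest : T (not (used y) ∧ not (spoilt y))
        rest = T-∧⁻ʳ {Cx y} y-good
      bad : Fin N → Bool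
      bad y = used y ∨ anyᵇ (λ u → affected u ∧ spoilers u y)
      split : ∀ y → T (Cx y) → T (good y) ⊎ T (bad y)
      split y cy with used y
      ... | true  = inj₂ tt
      ... | false with spoilt y in spoilt-y
      ...   | false = inj₁ (T-∧⁺ cy tt)
      ...   | true  = let u , t = anyᵇ-elim (λ u → affected u ∧ sparse u y) (≡true⇒T spoilt-y)
                      in inj₂ (anyᵇ-intro _ u (T-∧⁺ (T-∧⁻ˡ {affected u} t) (T-∧⁺ cy (T-∧⁻ʳ {affected u} t))))
      used-few : count used ≤ k
      used-few = ≤-trans (count-anyᵇ k (λ w y → E w ∧ does (φ w ≟ y)) 1
                   (λ w → ≤-trans (count-mono _ (λ y → does (φ w ≟ y)) (λ _ → T-∧⁻ʳ {E w})) (count-≟ (φ w))))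
                 (≤-reflexive (*-identityʳ k))
      spoilt-few : count (λ y → anyᵇ (λ u → affected u ∧ spoilers u y)) ≤ k * n
      spoilt-few = count-anyᵇ k (λ u y → affected u ∧ spoilers u y) n per-vertex
        where
        per-vertex : ∀ u → count (λ y → affected u ∧ spoilers u y) ≤ n
        per-vertex u with affected u in aff
        ... | true  = <⇒≤ (few u (≡true⇒T aff))
        ... | false = ≤-trans (≤-reflexive (count-empty {N} (λ _ → false) (λ _ ()))) z≤n

    module Place (y : Fin N) (y∈Cx : T (Cx y)) (fresh : ¬ T (used y))
                 (rich : ∀ u → T (affected u) → ¬ T (sparse u y)) where

      ψ : Fin k → Fin N
      ψ w with x ≟ w
      ... | yes _ = y
      ... | no  _ = φ w

      y-adj : ∀ {w} → T (E w) → T (adj H x w) → T (adj G (φ w) y)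
      y-adj {w} w∈E xw = T-⇒ᵇ⁻ (allᵇ-elim _ y∈Cx w) (T-∧⁺ w∈E xw)

      y-unused : ∀ {w} → T (E w) → y ≢ φ w
      y-unused {w} w∈E y≡φw = fresh (anyᵇ-intro (λ w → E w ∧ does (φ w ≟ y)) w
        (T-∧⁺ w∈E (≡true⇒T (dec-true (φ w ≟ y) (≡.sym y≡φw)))))

      -- Abstracting x ≟ a also reduces ψ a in the types of the hypotheses, e.g. ψa≡ψb.
      ψ-injective : ∀ {a b} → T (S a) → T (S b) → ψ a ≡ ψ b → a ≡ b
      ψ-injective {a} {b} a∈S b∈S ψa≡ψb with x ≟ a | x ≟ b
      ... | yes refl | yes refl = refl
      ... | yes refl | no  x≢b  = ⊥-elim (y-unused (∈E b∈S x≢b) ψa≡ψb)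
      ... | no  x≢a  | yes refl = ⊥-elim (y-unused (∈E a∈S x≢a) (≡.sym ψa≡ψb))
      ... | no  x≢a  | no  x≢b  = injective (∈E a∈S x≢a) (∈E b∈S x≢b) ψa≡ψb

      ψ-adj : ∀ {a b} → T (S a) → T (S b) → T (adj H a b) → T (adj G (ψ a) (ψ b))
      ψ-adj {a} {b} a∈S b∈S ab with x ≟ a | x ≟ b
      ... | yes refl | yes refl = ⊥-elim (subst T (irref H x) ab)
      ... | yes refl | no  x≢b  = subst T (sym G (φ b) y) (y-adj (∈E b∈S x≢b) ab)
      ... | no  x≢a  | yes refl = y-adj (∈E a∈S x≢a) (subst T (sym H a x) ab)
      ... | no  x≢a  | no  x≢b  = adj-preserving (∈E a∈S x≢a) (∈E b∈S x≢b) ab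

      candidates-ψ : ∀ {u z} → T (candidates φ E u z) → (T (adj H u x) → T (adj G y z)) →
        T (candidates ψ S u z)
      candidates-ψ {u} {z} cz yz = allᵇ-intro _ λ w → T-⇒ᵇ⁺ λ t → ψw-adj w (T-∧⁻ˡ {S w} t) (T-∧⁻ʳ {S w} t)
        where
        ψw-adj : ∀ w → T (S w) → T (adj H u w) → T (adj G (ψ w) z)
        ψw-adj w w∈S uw with x ≟ w
        ... | yes refl = yz uw
        ... | no  x≢w  = T-⇒ᵇ⁻ (allᵇ-elim _ cz w) (T-∧⁺ (∈E w∈S x≢w) uw)

      ψ-room : ∀ u → ¬ T (S u) → degreeWithin S u ≤ r → g (r ∸ degreeWithin S u) ≤ count (candidates ψ S u)
      ψ-room u u∉S du with adj H u x in ux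
      ... | true  = ≤-trans (≮⇒≥ (rich u (T-∧⁺ (T-not⁺ u∉S) (T-∧⁺ (≡true⇒T ux) (≤⇒≤ᵇ du))) ∘ <⇒<ᵇ))
                      (count-mono _ _ λ z t → candidates-ψ (T-∧⁻ˡ {candidates φ E u z} t)
                                                          (λ _ → T-∧⁻ʳ {candidates φ E u z} t))
      ... | false = ≤-trans (threshold-mono k n (∸-monoʳ-≤ r (degreeWithin-mono E⊆S u)))
                      (≤-trans (room-outside-S u u∉S du)
                        (count-mono (candidates φ E u) (candidates ψ S u)
                                    λ z t → candidates-ψ t (λ ux′ → ⊥-elim (subst T ux ux′))))

      extended : PartialEmbedding S
      extended = record { φ = ψ ; injective = ψ-injective ; adj-preserving = ψ-adj ; room = ψ-room }

    outcome : Outcome S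
    outcome with any? (λ u → T? (affected u) ×-dec (n ≤? count (spoilers u)))
    ... | yes (u , aff , many) = inj₁ (many-spoilers⇒Knn u aff many)
    ... | no  ¬many with few-spoilers⇒good (λ u aff → ≰⇒> (λ many → ¬many (u , aff , many)))
    ...   | y , y∈Cx , fresh , rich = inj₂ (Place.extended y y∈Cx fresh rich)

  greedy : Degenerate r H → g r ≤ N → ∀ m S → count S ≤ m → Outcome S
  greedy dgn large m S size with any? (λ y → T? (S y))
  ... | no none = inj₂ (emptyEmbedding large (λ y y∈S → none (y , y∈S)))
  greedy dgn large zero S size | yes (y , y∈S) = ⊥-elim (<⇒≱ (count-pos S y y∈S) size)
  greedy dgn large (suc m) S size | yes (y , y∈S) with degenerate⇒lowDegree dgn S y y∈S
  ... | x , x∈S , deg-x with greedy dgn large m (S - x) (≤-pred (≤-trans (count-- {S = S} x∈S) size))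
  ...   | inj₁ knn = inj₁ knn
  ...   | inj₂ e   = Extension.outcome S x x∈S deg-x e

  total⇒contains : PartialEmbedding (λ _ → true) → Contains H G
  total⇒contains e = φ , injective tt tt , λ _ _ → adj-preserving tt tt
    where open PartialEmbedding e

corollary5p8 : (r k : ℕ) (H : Graph k) → Degenerate r H →
    ∃ λ C → (n N : ℕ) → C * n ^ (r + 1) ≤ N → (G : Graph N) →
      Contains H G ⊎ ContainsKnn n (complement G)
corollary5p8 r k H dgn = thresholdConstant k r , H-or-Knn
  where
  H-or-Knn : (n N : ℕ) → thresholdConstant k r * n ^ (r + 1) ≤ N → (G : Graph N) →
    Contains H G ⊎ ContainsKnn n (complement G)
  H-or-Knn zero N _ G = inj₂ (containsKnn-zero (complement G))
  H-or-Knn n@(suc _) N large G =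
    [ inj₂ , inj₁ ∘ total⇒contains ]′ (greedy dgn large′ k (λ _ → true) (count≤ _))
    where
    open GreedyEmbedding H G r n
    large′ : g r ≤ N
    large′ = ≤-trans (threshold≤ k n r) (subst (λ e → thresholdConstant k r * n ^ e ≤ N) (+-comm r 1) large)
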